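{- Let $k>1$ be an integer. The smallest odd positive integer $n$ with $\lambda(n)=k$ is $g(k)$, and the smallest even positive integer $n$ with $\lambda(n)=k$ is $2g(k)$.
   Context: Let $\overline{\psi}$ be the multiplicative arithmetic function with $\overline{\psi}(p^{\alpha})=p^{\alpha-1}(p+1)$ for odd primes $p$ and $\overline{\psi}(2^{\alpha})=2^{\alpha-1}$, for all positive integers $\alpha$ (so $\overline{\psi}(1)=1$). For $n>1$, $\lambda(n)$ is the unique nonnegative integer with $\overline{\psi}^{\lambda(n)}(n)=2$ (where $\overline{\psi}^k$ is the $k$-th iterate, $\overline{\psi}^0(n)=n$), and $\lambda(1)=0$. Define $g(k)$ for integers $k\geq 2$ by $g(k)=5^{k/3}$ if $k\equiv 0\pmod 3$, $g(k)=9\cdot 5^{(k-4)/3}$ if $k\equiv 1\pmod 3$, and $g(k)=3\cdot 5^{(k-2)/3}$ if $k\equiv 2\pmod 3$. -}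

module Defs where

open import Data.Nat using (ℕ; zero; suc; _+_; _*_; _∸_; _^_; _≤_; _<_)
open import Data.Nat.DivMod using (_/_; _%_)
open import Data.Nat.Divisibility using (_∣?_)
open import Data.Nat.Primality using (prime?)
open import Data.List using (List; []; _∷_; map; filter; upTo)
open import Data.Nat.ListAction using (product)
open import Data.Product using (_×_)
open import Data.Sum using (_⊎_)
open import Relation.Nullary using (yes; no)
open import Relation.Binary.PropositionalEquality using (_≡_)
open import Function using (_∘_)

-- exponent of the prime p = q+2 in n (fuel-bounded; fuel = n suffices for n ≥ 1)
val' : ℕ → ℕ → ℕ → ℕ
val' zero q n = 0
val' (suc f) q zero = 0
val' (suc f) q (suc m) with suc (suc q) ∣? suc m
... | yes _ = suc (val' f q (suc m / suc (suc q)))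
... | no  _ = 0

val : ℕ → ℕ → ℕ
val zero n = 0
val (suc zero) n = 0
val (suc (suc q)) n = val' n q n

ψ̄pp : ℕ → ℕ → ℕ
ψ̄pp p zero = 1
ψ̄pp 2 (suc a) = 2 ^ a
ψ̄pp p (suc a) = p ^ a * (p + 1)

primesUpTo : ℕ → List ℕ
primesUpTo n = filter prime? (upTo (suc n))

ψ̄ : ℕ → ℕ
ψ̄ n = product (map (λ p → ψ̄pp p (val p n)) (primesUpTo n))

iter : ℕ → (ℕ → ℕ) → ℕ → ℕ
iter zero f n = n
iter (suc k) f n = f (iter k f n)

-- "λ(n) = k" as a relation: λ(1) = 0, and for n > 1, ψ̄^k(n) = 2
-- (the k with ψ̄^k(n) = 2 is unique since ψ̄(2) = ψ̄(1) = 1)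
Lambda : ℕ → ℕ → Set
Lambda n k = (n ≡ 1 × k ≡ 0) ⊎ (1 < n × iter k ψ̄ n ≡ 2)

g : ℕ → ℕ
g k with k % 3
... | 0 = 5 ^ (k / 3)
... | 1 = 9 * 5 ^ ((k ∸ 4) / 3)
... | _ = 3 * 5 ^ ((k ∸ 2) / 3)

Odd : ℕ → Set
Odd n = n % 2 ≡ 1

Even : ℕ → Set
Even n = n % 2 ≡ 0

-- Let D be the completely additive function with D 2 = 1 and D p = 1 + D ((p + 1) / 2) for odd
-- primes p, so that D (p + 1) = D p. As ψ̄ (p ^ a) = p ^ (a - 1) * (p + 1) for odd p and
-- ψ̄ (2 ^ a) = 2 ^ (a - 1), we get D (ψ̄ n) = D n for odd n and D (ψ̄ n) = D n - 1 for even n; since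
-- ψ̄ n is even for n ≥ 3, iterating ψ̄ gives λ n = D n for odd n > 1 and λ n = D n - 1 for even n.
-- So both halves of the theorem ask for the least n with D n = k (for even n = 2 m, λ n = D m),
-- and this least n is g k, which is odd. Extend g by ĝ 0 = 1 and ĝ 1 = 2: ĝ is submultiplicative
-- and odd away from 1, whence ĝ (D p) ≤ p for primes p and, multiplying over the prime factors,
-- ĝ (D n) ≤ n for all n ≥ 1; conversely D (g k) = k because D 3 = 2 and D 5 = 3.

module Submission where

open import Defs
open import Data.Nat
open import Data.Nat.Properties
open import Data.Nat.Divisibility
open import Data.Nat.DivMod
open import Data.Nat.Primality
open import Data.Nat.Induction using (<-Rec; <-rec; <-wellFounded)
open import Induction.WellFounded using (module FixPoint)
open import Data.Nat.ListAction using (product)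
open import Data.Nat.ListAction.Properties using (product-++)
open import Data.List using (List; []; _∷_; map; filter; upTo; _++_)
open import Data.List.Properties using (upTo-∷ʳ; filter-++; map-++)
open import Data.Product using (_×_; _,_; proj₁; proj₂; ∃-syntax)
open import Data.Sum using (_⊎_; inj₁; inj₂; [_,_]′)
open import Data.Empty using (⊥-elim)
open import Data.Bool using (if_then_else_)
open import Function using (_∘_; id)
open import Relation.Nullary using (yes; no; does)
open import Relation.Nullary.Decidable using (from-yes; from-no)
open import Relation.Binary.PropositionalEquality
open import Relation.Binary.Definitions using (tri<; tri≈; tri>)
open import Algebra.Properties.CommutativeSemigroup *-commutativeSemigroup using (interchange; x∙yz≈y∙xz)
open import Algebra.Properties.CommutativeSemigroup +-commutativeSemigroup as +-Properties using ()

prime⇒>1 : ∀ {p} → Prime p → 1 < p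
prime⇒>1 pr = nonTrivial⇒n>1 _ {{prime⇒nonTrivial pr}}

prime⇒>0 : ∀ {p} → Prime p → 0 < p
prime⇒>0 pr = <-trans z<s (prime⇒>1 pr)

^-monoʳ-∣ : ∀ p {a b} → a ≤ b → p ^ a ∣ p ^ b
^-monoʳ-∣ p {a} {b} a≤b = divides (p ^ (b ∸ a)) (begin
  p ^ b             ≡⟨ cong (p ^_) (sym (m∸n+n≡m a≤b)) ⟩
  p ^ (b ∸ a + a)   ≡⟨ ^-distribˡ-+-* p (b ∸ a) a ⟩
  p ^ (b ∸ a) * p ^ a ∎)
  where open ≡-Reasoning

*-positive : ∀ {m n} → 0 < m → 0 < n → 0 < m * n
*-positive {suc m} {suc n} _ _ = z<s

^-positive : ∀ p a → 0 < p → 0 < p ^ a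
^-positive p a p>0 = m^n>0 p {{>-nonZero p>0}} a

cofactor-bounds : ∀ {p n m} → 1 < p → 0 < n → n ≡ p * m → 0 < m × m < n
cofactor-bounds {p} {n} {zero} _ n>0 n≡pm = ⊥-elim (<⇒≢ n>0 (sym (trans n≡pm (*-zeroʳ p))))
cofactor-bounds {p} {n} {m@(suc _)} p>1 _ refl = z<s , subst (m <_) (*-comm m p) (m<m*n m p p>1)

prime∣prime⇒≡ : ∀ {q p} → Prime q → Prime p → q ∣ p → q ≡ p
prime∣prime⇒≡ prq prp q∣p with prime⇒irreducible prp q∣p
... | inj₂ q≡p = q≡p
... | inj₁ refl = ⊥-elim (¬prime[1] prq)

prime∣prime^⇒≡ : ∀ {q p} a → Prime q → Prime p → q ∣ p ^ a → q ≡ p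
prime∣prime^⇒≡ zero prq prp q∣1 with refl ← ∣1⇒≡1 q∣1 = ⊥-elim (¬prime[1] prq)
prime∣prime^⇒≡ {q} {p} (suc a) prq prp q∣pᵃ⁺¹ with euclidsLemma p (p ^ a) prq q∣pᵃ⁺¹
... | inj₁ q∣p = prime∣prime⇒≡ prq prp q∣p
... | inj₂ q∣pᵃ = prime∣prime^⇒≡ a prq prp q∣pᵃ

even-or-odd : ∀ n → 2 ∣ n ⊎ 2 ∣ suc n
even-or-odd zero = inj₁ (divides 0 refl)
even-or-odd (suc n) = [ (λ 2∣n → inj₂ (∣m∣n⇒∣m+n (∣-refl {2}) 2∣n)) , inj₁ ]′ (even-or-odd n)

odd⇒suc-even : ∀ {n} → 2 ∤ n → 2 ∣ suc n
odd⇒suc-even {n} 2∤n = [ (λ 2∣n → ⊥-elim (2∤n 2∣n)) , id ]′ (even-or-odd n)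

odd⇒suc≡2*⌈/2⌉ : ∀ {n} → 2 ∤ n → suc n ≡ 2 * ⌈ n /2⌉
odd⇒suc≡2*⌈/2⌉ {n} 2∤n with odd⇒suc-even 2∤n
... | divides q 1+n≡q*2 = begin
  suc n              ≡⟨ 1+n≡q*2 ⟩
  q * 2              ≡⟨ *-comm q 2 ⟩
  2 * q              ≡⟨ cong (2 *_) (n≡⌊n+n/2⌋ q) ⟩
  2 * ⌊ q + q /2⌋    ≡⟨ cong (λ k → 2 * ⌊ k /2⌋) (trans (cong (q +_) (sym (+-identityʳ q))) (*-comm 2 q)) ⟩
  2 * ⌊ q * 2 /2⌋    ≡⟨ cong (λ k → 2 * ⌊ k /2⌋) 1+n≡q*2 ⟨
  2 * ⌈ n /2⌉        ∎
  where open ≡-Reasoning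

⌈n/2⌉-bounds : ∀ {n} → 1 < n → 0 < ⌈ n /2⌉ × ⌈ n /2⌉ < n
⌈n/2⌉-bounds {1} (s≤s ())
⌈n/2⌉-bounds {suc (suc k)} _ = z<s , ⌈n/2⌉<n k

prime⇒≡2⊎odd : ∀ {p} → Prime p → p ≡ 2 ⊎ 2 ∤ p
prime⇒≡2⊎odd {p} prp with 2 ∣? p
... | yes 2∣p = inj₁ (sym (prime∣prime⇒≡ prime[2] prp 2∣p))
... | no 2∤p = inj₂ 2∤p

even⇒>1 : ∀ {n} → 0 < n → 2 ∣ n → 1 < n
even⇒>1 {1} _ 2∣1 with () ← ∣1⇒≡1 2∣1
even⇒>1 {suc (suc _)} _ _ = s≤s (s≤s z≤n)

odd-cofactor>2 : ∀ {m} → 2 < 2 * m → 2 ∤ m → 2 < m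
odd-cofactor>2 {1} (s≤s (s≤s ()))
odd-cofactor>2 {2} _ 2∤2 = ⊥-elim (2∤2 ∣-refl)
odd-cofactor>2 {suc (suc (suc _))} _ _ = s≤s (s≤s (s≤s z≤n))

odd≤even⇒≤pred : ∀ {m n} → m ≤ suc n → 2 ∤ m → 2 ∣ suc n → m ≤ n
odd≤even⇒≤pred m≤1+n 2∤m 2∣1+n with m≤n⇒m<n∨m≡n m≤1+n
... | inj₁ m<1+n = ≤-pred m<1+n
... | inj₂ refl = ⊥-elim (2∤m 2∣1+n)

Odd⇒2∤ : ∀ {n} → Odd n → 2 ∤ n
Odd⇒2∤ {n} n%2≡1 2∣n with () ← trans (sym n%2≡1) (n∣m⇒m%n≡0 n 2 2∣n)

2∤⇒Odd : ∀ {n} → 2 ∤ n → Odd n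
2∤⇒Odd {n} 2∤n with n % 2 | m%n<n n 2 | m%n≡0⇒n∣m n 2
... | 0 | _ | 2∣n = ⊥-elim (2∤n (2∣n refl))
... | 1 | _ | _ = refl
... | suc (suc _) | s≤s (s≤s ()) | _

-- p-adic valuations

val'-spec : ∀ fuel q n → 0 < n → n ≤ fuel →
  (2 + q) ^ val' fuel q n ∣ n × (2 + q) ^ suc (val' fuel q n) ∤ n
val'-spec zero q n n>0 n≤0 with () ← ≤-trans n>0 n≤0
val'-spec (suc fuel) q (suc m) _ n≤fuel with 2 + q ∣? suc m
... | no p∤n = divides (suc m) (sym (*-identityʳ (suc m))) ,
               λ p∣n → p∤n (subst (_∣ suc m) (*-identityʳ (2 + q)) p∣n)
... | yes p∣n = subst (p ^ suc v ∣_) p*n′≡n (*-monoʳ-∣ p (proj₁ ih)) ,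
                λ p^2+v∣n → proj₂ ih (*-cancelˡ-∣ p (subst (p ^ suc (suc v) ∣_) (sym p*n′≡n) p^2+v∣n))
  where
  p = 2 + q
  n′ = suc m / p
  p*n′≡n : p * n′ ≡ suc m
  p*n′≡n = m*[n/m]≡n p∣n
  n′-bounds = cofactor-bounds {p} (s≤s (s≤s z≤n)) z<s (sym p*n′≡n)
  ih = val'-spec fuel q n′ (proj₁ n′-bounds) (≤-pred (≤-trans (proj₂ n′-bounds) n≤fuel))
  v = val' fuel q n′

val-spec : ∀ {p n} → 1 < p → 0 < n → p ^ val p n ∣ n × p ^ suc (val p n) ∤ n
val-spec {1} (s≤s ())
val-spec {suc (suc q)} {n} _ n>0 = val'-spec n q n n>0 ≤-refl

val-unique : ∀ {p n a} → 1 < p → 0 < n → p ^ a ∣ n → p ^ suc a ∤ n → val p n ≡ a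
val-unique {p} {n} {a} p>1 n>0 pᵃ∣n pᵃ⁺¹∤n with val-spec p>1 n>0 | <-cmp (val p n) a
... | _ , _ | tri≈ _ v≡a _ = v≡a
... | _ , pᵛ⁺¹∤n | tri< v<a _ _ = ⊥-elim (pᵛ⁺¹∤n (∣-trans (^-monoʳ-∣ p v<a) pᵃ∣n))
... | pᵛ∣n , _ | tri> _ _ a<v = ⊥-elim (pᵃ⁺¹∤n (∣-trans (^-monoʳ-∣ p a<v) pᵛ∣n))

val-≡0 : ∀ {p n} → Prime p → 0 < n → p ∤ n → val p n ≡ 0
val-≡0 {p} {n} pr n>0 p∤n = val-unique (prime⇒>1 pr) n>0 (divides n (sym (*-identityʳ n)))
  (λ p∣n → p∤n (subst (_∣ n) (*-identityʳ p) p∣n))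

val-^ : ∀ {p} a → Prime p → val p (p ^ a) ≡ a
val-^ {p} a pr = val-unique (prime⇒>1 pr) pᵃ>0 ∣-refl
  (λ pᵃ⁺¹∣pᵃ → <⇒≱ pᵃ<pᵃ⁺¹ (∣⇒≤ {{>-nonZero pᵃ>0}} pᵃ⁺¹∣pᵃ))
  where
  pᵃ>0 = ^-positive p a (prime⇒>0 pr)
  pᵃ<pᵃ⁺¹ : p ^ a < p ^ suc a
  pᵃ<pᵃ⁺¹ = subst (p ^ a <_) (*-comm (p ^ a) p) (m<m*n (p ^ a) p {{>-nonZero pᵃ>0}} (prime⇒>1 pr))

val-*-coprime : ∀ {p m n} → Prime p → 0 < m → 0 < n → p ∤ n → val p (m * n) ≡ val p m
val-*-coprime {p} {m} {n} pr m>0 n>0 p∤n =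
  val-unique (prime⇒>1 pr) (*-positive m>0 n>0) (∣m⇒∣m*n n pᵛ∣m) pᵛ⁺¹∤mn
  where
  v = val p m
  pᵛ∣m = proj₁ (val-spec (prime⇒>1 pr) m>0)
  m′ = quotient pᵛ∣m
  m≡pᵛm′ : m ≡ p ^ v * m′
  m≡pᵛm′ = m∣n⇒n≡m*quotient pᵛ∣m
  p∤m′ : p ∤ m′
  p∤m′ p∣m′ = proj₂ (val-spec (prime⇒>1 pr) m>0)
    (subst₂ _∣_ (*-comm (p ^ v) p) (sym m≡pᵛm′) (*-monoʳ-∣ (p ^ v) p∣m′))
  pᵛ⁺¹∤mn : p ^ suc v ∤ m * n
  pᵛ⁺¹∤mn pᵛ⁺¹∣mn = [ p∤m′ , p∤n ]′ (euclidsLemma m′ n pr p∣m′n)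
    where
    p∣m′n : p ∣ m′ * n
    p∣m′n = *-cancelˡ-∣ (p ^ v) {{m^n≢0 p v {{prime⇒nonZero pr}}}}
      (subst₂ _∣_ (*-comm p (p ^ v)) (trans (cong (_* n) m≡pᵛm′) (*-assoc (p ^ v) m′ n)) pᵛ⁺¹∣mn)

val-≡0-beyond : ∀ {q n} → Prime q → 0 < n → n < q → val q n ≡ 0
val-≡0-beyond prq n>0 n<q = val-≡0 prq n>0 (λ q∣n → <⇒≱ n<q (∣⇒≤ {{>-nonZero n>0}} q∣n))

-- ψ̄ is multiplicative

primeProduct : (ℕ → ℕ) → ℕ → ℕ
primeProduct f N = product (map f (primesUpTo N))

primesUpTo-suc : ∀ N → primesUpTo (suc N) ≡ primesUpTo N ++ filter prime? (suc N ∷ [])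
primesUpTo-suc N = trans (cong (filter prime?) (sym (upTo-∷ʳ (suc N))))
                         (filter-++ prime? (upTo (suc N)) (suc N ∷ []))

primeProduct-suc : ∀ f N →
  primeProduct f (suc N) ≡ primeProduct f N * (if does (prime? (suc N)) then f (suc N) else 1)
primeProduct-suc f N
  rewrite primesUpTo-suc N
        | map-++ f (primesUpTo N) (filter prime? (suc N ∷ []))
        | product-++ (map f (primesUpTo N)) (map f (filter prime? (suc N ∷ [])))
  with prime? (suc N)
... | yes _ = cong (primeProduct f N *_) (*-identityʳ (f (suc N)))
... | no _ = refl

primeProduct-stable : ∀ f {M N} → M ≤ N → (∀ q → Prime q → M < q → q ≤ N → f q ≡ 1) →
  primeProduct f N ≡ primeProduct f M
primeProduct-stable f {M} {zero} z≤n _ = refl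
primeProduct-stable f {M} {suc N} M≤1+N trivial with m≤n⇒m<n∨m≡n M≤1+N
... | inj₂ refl = refl
... | inj₁ M<1+N = begin
  primeProduct f (suc N)                                  ≡⟨ primeProduct-suc f N ⟩
  primeProduct f N * (if does (prime? (suc N)) then f (suc N) else 1)
    ≡⟨ cong₂ _*_ (primeProduct-stable f (≤-pred M<1+N) below-N) last-factor ⟩
  primeProduct f M * 1                                    ≡⟨ *-identityʳ _ ⟩
  primeProduct f M                                        ∎
  where
  open ≡-Reasoning
  below-N : ∀ q → Prime q → M < q → q ≤ N → f q ≡ 1
  below-N q prq M<q q≤N = trivial q prq M<q (m≤n⇒m≤1+n q≤N)
  last-factor : (if does (prime? (suc N)) then f (suc N) else 1) ≡ 1
  last-factor with prime? (suc N)
  ... | yes pr = trivial (suc N) pr M<1+N ≤-refl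
  ... | no _ = refl

primeProduct-single : ∀ f {p N} → Prime p → p ≤ N → (∀ q → Prime q → q ≢ p → q ≤ N → f q ≡ 1) →
  primeProduct f N ≡ f p
primeProduct-single f {suc p₀} {N} pr p≤N trivial = begin
  primeProduct f N             ≡⟨ primeProduct-stable f p≤N (λ q prq p<q → trivial q prq (>⇒≢ p<q)) ⟩
  primeProduct f (suc p₀)      ≡⟨ primeProduct-suc f p₀ ⟩
  primeProduct f p₀ * (if does (prime? (suc p₀)) then f (suc p₀) else 1)
    ≡⟨ cong₂ _*_ (primeProduct-stable f z≤n below-p) p-factor ⟩
  1 * f (suc p₀)               ≡⟨ *-identityˡ _ ⟩
  f (suc p₀)                   ∎
  where
  open ≡-Reasoning
  below-p : ∀ q → Prime q → 0 < q → q ≤ p₀ → f q ≡ 1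
  below-p q prq _ q≤p₀ = trivial q prq (<⇒≢ (s≤s q≤p₀)) (≤-trans (m≤n⇒m≤1+n q≤p₀) p≤N)
  p-factor : (if does (prime? (suc p₀)) then f (suc p₀) else 1) ≡ f (suc p₀)
  p-factor with prime? (suc p₀)
  ... | yes _ = refl
  ... | no ¬pr = ⊥-elim (¬pr pr)

primeProduct-cong : ∀ f g N → (∀ q → Prime q → q ≤ N → f q ≡ g q) → primeProduct f N ≡ primeProduct g N
primeProduct-cong f g zero _ = refl
primeProduct-cong f g (suc N) f≗g
  rewrite primeProduct-suc f N | primeProduct-suc g N
        | primeProduct-cong f g N (λ q pr q≤N → f≗g q pr (m≤n⇒m≤1+n q≤N))
  with prime? (suc N)
... | yes pr = cong (primeProduct g N *_) (f≗g (suc N) pr ≤-refl)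
... | no _ = refl

product-map-* : ∀ f g (xs : List ℕ) → product (map (λ x → f x * g x) xs) ≡ product (map f xs) * product (map g xs)
product-map-* f g [] = refl
product-map-* f g (x ∷ xs) rewrite product-map-* f g xs = interchange (f x) (g x) (product (map f xs)) (product (map g xs))

ψ̄-*-coprime : ∀ {m n} → 0 < m → 0 < n → (∀ p → Prime p → p ∣ m → p ∤ n) → ψ̄ (m * n) ≡ ψ̄ m * ψ̄ n
ψ̄-*-coprime {m} {n} m>0 n>0 coprime = begin
  ψ̄ (m * n)                                      ≡⟨ primeProduct-cong _ _ (m * n) split-factor ⟩
  primeProduct (λ p → fₘ p * fₙ p) (m * n)        ≡⟨ product-map-* fₘ fₙ (primesUpTo (m * n)) ⟩
  primeProduct fₘ (m * n) * primeProduct fₙ (m * n)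
    ≡⟨ cong₂ _*_ (primeProduct-stable fₘ (m≤m*n m n {{>-nonZero n>0}}) (beyond m>0))
                 (primeProduct-stable fₙ (m≤n*m n m {{>-nonZero m>0}}) (beyond n>0)) ⟩
  ψ̄ m * ψ̄ n                                      ∎
  where
  open ≡-Reasoning
  fₘ fₙ : ℕ → ℕ
  fₘ p = ψ̄pp p (val p m)
  fₙ p = ψ̄pp p (val p n)
  beyond : ∀ {k} → 0 < k → ∀ q → Prime q → k < q → q ≤ m * n → ψ̄pp q (val q k) ≡ 1
  beyond k>0 q prq k<q _ rewrite val-≡0-beyond prq k>0 k<q = refl
  split-factor : ∀ p → Prime p → p ≤ m * n → ψ̄pp p (val p (m * n)) ≡ fₘ p * fₙ p
  split-factor p prp _ with p ∣? n
  ... | yes p∣n rewrite *-comm m n | val-*-coprime prp n>0 m>0 (λ p∣m → coprime p prp p∣m p∣n)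
                      | val-≡0 prp m>0 (λ p∣m → coprime p prp p∣m p∣n) = sym (*-identityˡ _)
  ... | no p∤n rewrite val-*-coprime prp m>0 n>0 p∤n | val-≡0 prp n>0 p∤n = sym (*-identityʳ _)

ψ̄-^ : ∀ {p} a → Prime p → ψ̄ (p ^ a) ≡ ψ̄pp p a
ψ̄-^ zero _ = refl
ψ̄-^ {p} (suc a) prp = trans
  (primeProduct-single (λ q → ψ̄pp q (val q (p ^ suc a))) prp p≤pᵃ⁺¹ other-primes)
  (cong (ψ̄pp p) (val-^ (suc a) prp))
  where
  p≤pᵃ⁺¹ : p ≤ p ^ suc a
  p≤pᵃ⁺¹ = m≤m*n p (p ^ a) {{m^n≢0 p a {{prime⇒nonZero prp}}}}
  other-primes : ∀ q → Prime q → q ≢ p → q ≤ p ^ suc a → ψ̄pp q (val q (p ^ suc a)) ≡ 1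
  other-primes q prq q≢p _
    rewrite val-≡0 prq (^-positive p (suc a) (prime⇒>0 prp)) (q≢p ∘ prime∣prime^⇒≡ (suc a) prq prp) = refl

ψ̄-prime-power-* : ∀ {p m} a → Prime p → p ∤ m → 0 < m → ψ̄ (p ^ suc a * m) ≡ ψ̄pp p (suc a) * ψ̄ m
ψ̄-prime-power-* {p} {m} a prp p∤m m>0 = begin
  ψ̄ (p ^ suc a * m)        ≡⟨ ψ̄-*-coprime (^-positive p (suc a) (prime⇒>0 prp)) m>0 coprime ⟩
  ψ̄ (p ^ suc a) * ψ̄ m      ≡⟨ cong (_* ψ̄ m) (ψ̄-^ (suc a) prp) ⟩
  ψ̄pp p (suc a) * ψ̄ m      ∎
  where
  open ≡-Reasoning
  coprime : ∀ q → Prime q → q ∣ p ^ suc a → q ∤ m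
  coprime q prq q∣pᵃ⁺¹ rewrite prime∣prime^⇒≡ (suc a) prq prp q∣pᵃ⁺¹ = p∤m

firstDivisorFrom : ℕ → ℕ → ℕ → ℕ
firstDivisorFrom zero d n = d
firstDivisorFrom (suc fuel) d n with d ∣? n
... | yes _ = d
... | no _ = firstDivisorFrom fuel (suc d) n

leastPrimeFactor : ℕ → ℕ
leastPrimeFactor n = firstDivisorFrom n 2 n

firstDivisorFrom-spec : ∀ fuel d n → 1 < d → 1 < n → d Rough n → n ≤ fuel + d →
  let r = firstDivisorFrom fuel d n in 1 < r × r ∣ n × r Rough n
firstDivisorFrom-spec zero d n d>1 n>1 rough n≤d =
  d>1 , subst (_∣ n) (≤-antisym n≤d (rough⇒≤ {{n>1⇒nonTrivial n>1}} rough)) ∣-refl , rough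
firstDivisorFrom-spec (suc fuel) d n d>1 n>1 rough n≤ with d ∣? n
... | yes d∣n = d>1 , d∣n , rough
... | no d∤n = firstDivisorFrom-spec fuel (suc d) n (m<n⇒m<1+n d>1) n>1 (∤⇒rough-suc d∤n rough)
                 (subst (n ≤_) (sym (+-suc fuel d)) n≤)

leastPrimeFactor-spec : ∀ {n} → 1 < n → Prime (leastPrimeFactor n) × leastPrimeFactor n ∣ n
leastPrimeFactor-spec {n} n>1 with firstDivisorFrom-spec n 2 n (s≤s (s≤s z≤n)) n>1 2-rough (m≤m+n n 2)
... | p>1 , p∣n , rough = rough∧∣⇒prime {{n>1⇒nonTrivial p>1}} rough p∣n , p∣n

prime-factor : ∀ {n} → 1 < n → ∃[ p ] ∃[ m ] Prime p × n ≡ p * m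
prime-factor n>1 with leastPrimeFactor-spec n>1
... | prp , p∣n = _ , quotient p∣n , prp , m∣n⇒n≡m*quotient p∣n

prime-power-split : ∀ {p n} → Prime p → 0 < n → p ∣ n →
  ∃[ a ] ∃[ m ] n ≡ p ^ suc a * m × p ∤ m × 0 < m × m < n
prime-power-split {p} {n} prp n>0 p∣n with val p n | val-spec (prime⇒>1 prp) n>0
... | zero | _ , p∤n = ⊥-elim (p∤n (subst (_∣ n) (sym (*-identityʳ p)) p∣n))
... | suc a | pᵃ⁺¹∣n , pᵃ⁺²∤n = a , m , n≡pᵃ⁺¹m , p∤m , cofactor-bounds pᵃ⁺¹>1 n>0 n≡pᵃ⁺¹m
  where
  m = quotient pᵃ⁺¹∣n
  n≡pᵃ⁺¹m : n ≡ p ^ suc a * m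
  n≡pᵃ⁺¹m = m∣n⇒n≡m*quotient pᵃ⁺¹∣n
  p∤m : p ∤ m
  p∤m p∣m = pᵃ⁺²∤n (subst₂ _∣_ (*-comm (p ^ suc a) p) (sym n≡pᵃ⁺¹m) (*-monoʳ-∣ (p ^ suc a) p∣m))
  pᵃ⁺¹>1 : 1 < p ^ suc a
  pᵃ⁺¹>1 = ≤-trans (prime⇒>1 prp) (m≤m*n p (p ^ a) {{m^n≢0 p a {{prime⇒nonZero prp}}}})

prime-power-induction : (P : ℕ → Set) → P 1 →
  (∀ {p m} a → Prime p → p ∤ m → 0 < m → P m → P (p ^ suc a * m)) →
  ∀ {n} → 0 < n → P n
prime-power-induction P base step {n} = <-rec (λ n → 0 < n → P n) go n
  where
  go : ∀ n → (∀ {m} → m < n → 0 < m → P m) → 0 < n → P n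
  go 1 _ _ = base
  go n@(suc (suc _)) ih n>0 with prime-factor {n} (s≤s (s≤s z≤n))
  ... | p , _ , prp , n≡pm with prime-power-split prp n>0 (subst (p ∣_) (sym n≡pm) (m∣m*n _))
  ...   | a , m , n≡pᵃ⁺¹m , p∤m , m>0 , m<n = subst P (sym n≡pᵃ⁺¹m) (step a prp p∤m m>0 (ih m<n m>0))

Dₚ-step : ∀ n → <-Rec (λ _ → ℕ) n → ∀ p → p ≤ n → ℕ
Dₚ-step n rec 2 _ = 1
Dₚ-step n rec (suc (suc (suc k))) p≤n = suc (rec (<-≤-trans (⌈n/2⌉<n (suc k)) p≤n))
Dₚ-step n rec _ _ = 0

leastPrimeFactor-∣ : ∀ k → leastPrimeFactor (2 + k) ∣ 2 + k
leastPrimeFactor-∣ k = proj₂ (leastPrimeFactor-spec (s≤s (s≤s z≤n)))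

leastPrimeFactor-nonTrivial : ∀ k → NonTrivial (leastPrimeFactor (2 + k))
leastPrimeFactor-nonTrivial k = prime⇒nonTrivial (proj₁ (leastPrimeFactor-spec {2 + k} (s≤s (s≤s z≤n))))

D-step : ∀ n → <-Rec (λ _ → ℕ) n → ℕ
D-step n@(suc (suc k)) rec =
  Dₚ-step n rec (leastPrimeFactor n) (∣⇒≤ (leastPrimeFactor-∣ k)) + rec (quotient-< (leastPrimeFactor-∣ k) {{leastPrimeFactor-nonTrivial k}})
D-step _ _ = 0

D : ℕ → ℕ
D = <-rec (λ _ → ℕ) D-step

Dₚ : ℕ → ℕ
Dₚ 2 = 1
Dₚ p = suc (D ⌈ p /2⌉)

D-step-ext : ∀ n {rec rec′ : <-Rec (λ _ → ℕ) n} → (∀ {m} (m<n : m < n) → rec m<n ≡ rec′ m<n) →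
  D-step n rec ≡ D-step n rec′
D-step-ext n@(suc (suc k)) {rec} {rec′} rec≗rec′ = cong₂ _+_ (Dₚ-step-ext (leastPrimeFactor n) _) (rec≗rec′ _)
  where
  Dₚ-step-ext : ∀ p p≤n → Dₚ-step n rec p p≤n ≡ Dₚ-step n rec′ p p≤n
  Dₚ-step-ext 2 _ = refl
  Dₚ-step-ext (suc (suc (suc k))) _ = cong suc (rec≗rec′ _)
  Dₚ-step-ext 0 _ = refl
  Dₚ-step-ext 1 _ = refl
D-step-ext 0 _ = refl
D-step-ext 1 _ = refl

open FixPoint <-wellFounded (λ _ → ℕ) D-step D-step-ext using (unfold-wfRec)

D-1 : D 1 ≡ 0
D-1 = unfold-wfRec {1}

D-unfold : ∀ {n} → 1 < n → ∃[ m ] n ≡ leastPrimeFactor n * m × D n ≡ Dₚ (leastPrimeFactor n) + D m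
D-unfold {1} (s≤s ())
D-unfold {n@(suc (suc k))} _ = quotient (leastPrimeFactor-∣ k) , m∣n⇒n≡m*quotient (leastPrimeFactor-∣ k) ,
  trans (unfold-wfRec {n}) (cong (_+ D (quotient (leastPrimeFactor-∣ k))) (Dₚ-step-D (leastPrimeFactor n) _ lpf>1))
  where
  lpf>1 = prime⇒>1 (proj₁ (leastPrimeFactor-spec {n} (s≤s (s≤s z≤n))))
  Dₚ-step-D : ∀ p p≤n → 1 < p → Dₚ-step n (λ {m} _ → D m) p p≤n ≡ Dₚ p
  Dₚ-step-D 2 _ _ = refl
  Dₚ-step-D (suc (suc (suc _))) _ _ = refl
  Dₚ-step-D 1 _ (s≤s ())

-- Splitting off q or the least prime factor p of q * m first gives the same value, as p ∣ m when p ≢ q.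
D-prime-* : ∀ {q m} → Prime q → 0 < m → D (q * m) ≡ Dₚ q + D m
D-prime-* {q} {m} prq m>0 = <-rec P go m m>0 prq
  where
  P : ℕ → Set
  P m = 0 < m → ∀ {q} → Prime q → D (q * m) ≡ Dₚ q + D m
  go : ∀ m → (∀ {m′} → m′ < m → P m′) → P m
  go m ih m>0 {q} prq with leastPrimeFactor-spec qm>1 | D-unfold qm>1
    where qm>1 = *-mono-≤ (prime⇒>1 prq) m>0
  ... | prp , _ | m″ , qm≡pm″ , Dqm≡ with leastPrimeFactor (q * m) ≟ q
  ...   | yes p≡q = trans Dqm≡ (cong₂ (λ r k → Dₚ r + D k) p≡q
                        (*-cancelˡ-≡ m″ m q {{prime⇒nonZero prq}} (trans (cong (_* m″) (sym p≡q)) (sym qm≡pm″))))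
  ...   | no p≢q = begin
    D (q * m)            ≡⟨ Dqm≡ ⟩
    Dₚ p + D m″          ≡⟨ cong (λ k → Dₚ p + D k) m″≡qm′ ⟩
    Dₚ p + D (q * m′)    ≡⟨ cong (Dₚ p +_) (ih m′<m m′>0 prq) ⟩
    Dₚ p + (Dₚ q + D m′) ≡⟨ +-Properties.x∙yz≈y∙xz (Dₚ p) (Dₚ q) (D m′) ⟩
    Dₚ q + (Dₚ p + D m′) ≡⟨ cong (Dₚ q +_) (ih m′<m m′>0 prp) ⟨
    Dₚ q + D (p * m′)    ≡⟨ cong (λ k → Dₚ q + D k) m≡pm′ ⟨
    Dₚ q + D m           ∎
    where
    open ≡-Reasoning
    p = leastPrimeFactor (q * m)
    p∣m : p ∣ m
    p∣m = [ (λ p∣q → ⊥-elim (p≢q (prime∣prime⇒≡ prp prq p∣q))) , (λ p∣m → p∣m) ]′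
            (euclidsLemma q m prp (subst (p ∣_) (sym qm≡pm″) (m∣m*n m″)))
    m′ = quotient p∣m
    m≡pm′ : m ≡ p * m′
    m≡pm′ = m∣n⇒n≡m*quotient p∣m
    m′>0 = proj₁ (cofactor-bounds (prime⇒>1 prp) m>0 m≡pm′)
    m′<m = proj₂ (cofactor-bounds (prime⇒>1 prp) m>0 m≡pm′)
    m″≡qm′ : m″ ≡ q * m′
    m″≡qm′ = *-cancelˡ-≡ m″ (q * m′) p {{prime⇒nonZero prp}} (begin
      p * m″       ≡⟨ qm≡pm″ ⟨
      q * m        ≡⟨ cong (q *_) m≡pm′ ⟩
      q * (p * m′) ≡⟨ x∙yz≈y∙xz q p m′ ⟩
      p * (q * m′) ∎)

D-prime : ∀ {p} → Prime p → D p ≡ Dₚ p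
D-prime {p} prp = begin
  D p            ≡⟨ cong D (*-identityʳ p) ⟨
  D (p * 1)      ≡⟨ D-prime-* prp z<s ⟩
  Dₚ p + D 1     ≡⟨ cong (Dₚ p +_) D-1 ⟩
  Dₚ p + 0       ≡⟨ +-identityʳ (Dₚ p) ⟩
  Dₚ p           ∎
  where open ≡-Reasoning

D-2 : D 2 ≡ 1
D-2 = D-prime prime[2]

D-* : ∀ {m n} → 0 < m → 0 < n → D (m * n) ≡ D m + D n
D-* {m} {n} m>0 n>0 = <-rec (λ m → 0 < m → D (m * n) ≡ D m + D n) go m m>0
  where
  go : ∀ m → (∀ {m′} → m′ < m → 0 < m′ → D (m′ * n) ≡ D m′ + D n) → 0 < m → D (m * n) ≡ D m + D n
  go 1 _ _ = trans (cong D (+-identityʳ n)) (cong (_+ D n) (sym D-1))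
  go m@(suc (suc _)) ih m>0 with prime-factor {m} (s≤s (s≤s z≤n))
  ... | p , m′ , prp , m≡pm′ = subst (λ k → D (k * n) ≡ D k + D n) (sym m≡pm′) (begin
    D (p * m′ * n)        ≡⟨ cong D (*-assoc p m′ n) ⟩
    D (p * (m′ * n))      ≡⟨ D-prime-* prp (*-positive m′>0 n>0) ⟩
    Dₚ p + D (m′ * n)     ≡⟨ cong (Dₚ p +_) (ih m′<m m′>0) ⟩
    Dₚ p + (D m′ + D n)   ≡⟨ +-assoc (Dₚ p) (D m′) (D n) ⟨
    Dₚ p + D m′ + D n     ≡⟨ cong (_+ D n) (D-prime-* prp m′>0) ⟨
    D (p * m′) + D n      ∎)
    where
    open ≡-Reasoning
    m′>0 = proj₁ (cofactor-bounds (prime⇒>1 prp) m>0 m≡pm′)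
    m′<m = proj₂ (cofactor-bounds (prime⇒>1 prp) m>0 m≡pm′)

D-^ : ∀ {p} a → 0 < p → D (p ^ a) ≡ a * D p
D-^ zero _ = D-1
D-^ {p} (suc a) p>0 = trans (D-* p>0 (^-positive p a p>0)) (cong (D p +_) (D-^ a p>0))

D-positive : ∀ {n} → 1 < n → 0 < D n
D-positive n>1 with prime-factor n>1
... | p , m , prp , n≡pm =
  subst (0 <_) (sym (trans (cong D n≡pm) (D-prime-* prp m>0))) (≤-trans (Dₚ-positive p) (m≤m+n _ _))
  where
  m>0 = proj₁ (cofactor-bounds (prime⇒>1 prp) (<-trans z<s n>1) n≡pm)
  Dₚ-positive : ∀ p → 0 < Dₚ p
  Dₚ-positive 0 = z<s
  Dₚ-positive 1 = z<s
  Dₚ-positive 2 = z<s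
  Dₚ-positive (suc (suc (suc _))) = z<s

D>0⇒>1 : ∀ {n} → 0 < n → 0 < D n → 1 < n
D>0⇒>1 {1} _ D1>0 = ⊥-elim (<⇒≢ D1>0 (sym D-1))
D>0⇒>1 {suc (suc _)} _ _ = s≤s (s≤s z≤n)

D-suc-odd-prime : ∀ {p} → Prime p → 2 ∤ p → D (suc p) ≡ D p
D-suc-odd-prime {2} _ 2∤2 = ⊥-elim (2∤2 ∣-refl)
D-suc-odd-prime {p@(suc (suc (suc _)))} prp 2∤p = begin
  D (suc p)              ≡⟨ cong D (odd⇒suc≡2*⌈/2⌉ 2∤p) ⟩
  D (2 * ⌈ p /2⌉)        ≡⟨ D-* {2} {⌈ p /2⌉} z<s z<s ⟩
  D 2 + D ⌈ p /2⌉        ≡⟨ cong (_+ D ⌈ p /2⌉) D-2 ⟩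
  Dₚ p                   ≡⟨ D-prime prp ⟨
  D p                    ∎
  where open ≡-Reasoning

D-3 : D 3 ≡ 2
D-3 = trans (sym (D-suc-odd-prime (from-yes (prime? 3)) (from-no (2 ∣? 3))))
            (trans (D-* {2} {2} z<s z<s) (cong₂ _+_ D-2 D-2))

D-5 : D 5 ≡ 3
D-5 = trans (sym (D-suc-odd-prime (from-yes (prime? 5)) (from-no (2 ∣? 5))))
            (trans (D-* {2} {3} z<s z<s) (cong₂ _+_ D-2 D-3))

-- ψ̄ and D

ψ̄pp-odd : ∀ {p} a → Prime p → 2 ∤ p → ψ̄pp p (suc a) ≡ p ^ a * (p + 1)
ψ̄pp-odd {2} _ _ 2∤2 = ⊥-elim (2∤2 ∣-refl)
ψ̄pp-odd {suc (suc (suc _))} _ _ _ = refl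

ψ̄pp-positive : ∀ {p} a → Prime p → 0 < ψ̄pp p a
ψ̄pp-positive zero _ = z<s
ψ̄pp-positive {2} (suc a) _ = ^-positive 2 a z<s
ψ̄pp-positive {p@(suc (suc (suc _)))} (suc a) _ = *-positive (^-positive p a z<s) z<s

D-ψ̄pp-odd : ∀ {p} a → Prime p → 2 ∤ p → D (ψ̄pp p (suc a)) ≡ D (p ^ suc a)
D-ψ̄pp-odd {p} a prp 2∤p = begin
  D (ψ̄pp p (suc a))       ≡⟨ cong D (ψ̄pp-odd a prp 2∤p) ⟩
  D (p ^ a * (p + 1))     ≡⟨ D-* (^-positive p a p>0) (<-≤-trans p>0 (m≤m+n p 1)) ⟩
  D (p ^ a) + D (p + 1)   ≡⟨ cong₂ _+_ (D-^ a p>0) (trans (cong D (+-comm p 1)) (D-suc-odd-prime prp 2∤p)) ⟩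
  a * D p + D p           ≡⟨ +-comm (a * D p) (D p) ⟩
  suc a * D p             ≡⟨ D-^ (suc a) p>0 ⟨
  D (p ^ suc a)           ∎
  where
  open ≡-Reasoning
  p>0 = prime⇒>0 prp

ψ̄-positive : ∀ {n} → 0 < n → 0 < ψ̄ n
ψ̄-positive = prime-power-induction (λ n → 0 < ψ̄ n) z<s step
  where
  step : ∀ {p m} a → Prime p → p ∤ m → 0 < m → 0 < ψ̄ m → 0 < ψ̄ (p ^ suc a * m)
  step a prp p∤m m>0 ψ̄m>0 =
    subst (0 <_) (sym (ψ̄-prime-power-* a prp p∤m m>0)) (*-positive (ψ̄pp-positive (suc a) prp) ψ̄m>0)

D-ψ̄-odd : ∀ {n} → 0 < n → 2 ∤ n → D (ψ̄ n) ≡ D n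
D-ψ̄-odd = prime-power-induction (λ n → 2 ∤ n → D (ψ̄ n) ≡ D n) (λ _ → refl) step
  where
  step : ∀ {p m} a → Prime p → p ∤ m → 0 < m → (2 ∤ m → D (ψ̄ m) ≡ D m) →
    2 ∤ p ^ suc a * m → D (ψ̄ (p ^ suc a * m)) ≡ D (p ^ suc a * m)
  step {p} {m} a prp p∤m m>0 ih 2∤n = begin
    D (ψ̄ (p ^ suc a * m))               ≡⟨ cong D (ψ̄-prime-power-* a prp p∤m m>0) ⟩
    D (ψ̄pp p (suc a) * ψ̄ m)             ≡⟨ D-* (ψ̄pp-positive (suc a) prp) (ψ̄-positive m>0) ⟩
    D (ψ̄pp p (suc a)) + D (ψ̄ m)         ≡⟨ cong₂ _+_ (D-ψ̄pp-odd a prp 2∤p) (ih (2∤n ∘ ∣n⇒∣m*n (p ^ suc a))) ⟩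
    D (p ^ suc a) + D m                 ≡⟨ D-* (^-positive p (suc a) (prime⇒>0 prp)) m>0 ⟨
    D (p ^ suc a * m)                   ∎
    where
    open ≡-Reasoning
    2∤p : 2 ∤ p
    2∤p = 2∤n ∘ ∣m⇒∣m*n m ∘ ∣m⇒∣m*n (p ^ a)

D-ψ̄-even : ∀ {n} → 0 < n → 2 ∣ n → suc (D (ψ̄ n)) ≡ D n
D-ψ̄-even {n} n>0 2∣n with prime-power-split prime[2] n>0 2∣n
... | a , m , n≡2ᵃ⁺¹m , 2∤m , m>0 , _ = begin
  suc (D (ψ̄ n))                 ≡⟨ cong (suc ∘ D ∘ ψ̄) n≡2ᵃ⁺¹m ⟩
  suc (D (ψ̄ (2 ^ suc a * m)))   ≡⟨ cong (suc ∘ D) (ψ̄-prime-power-* a prime[2] 2∤m m>0) ⟩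
  suc (D (2 ^ a * ψ̄ m))         ≡⟨ cong suc (D-* (^-positive 2 a z<s) (ψ̄-positive m>0)) ⟩
  suc (D (2 ^ a) + D (ψ̄ m))     ≡⟨ cong (λ k → suc (D (2 ^ a) + k)) (D-ψ̄-odd m>0 2∤m) ⟩
  1 + (D (2 ^ a) + D m)         ≡⟨ cong (_+ (D (2 ^ a) + D m)) D-2 ⟨
  D 2 + (D (2 ^ a) + D m)       ≡⟨ +-assoc (D 2) (D (2 ^ a)) (D m) ⟨
  D 2 + D (2 ^ a) + D m         ≡⟨ cong (_+ D m) (D-* {2} z<s (^-positive 2 a z<s)) ⟨
  D (2 ^ suc a) + D m           ≡⟨ D-* (^-positive 2 (suc a) z<s) m>0 ⟨
  D (2 ^ suc a * m)             ≡⟨ cong D n≡2ᵃ⁺¹m ⟨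
  D n                           ∎
  where open ≡-Reasoning

ψ̄pp-odd-even : ∀ {p} a → Prime p → 2 ∤ p → 2 ∣ ψ̄pp p (suc a)
ψ̄pp-odd-even {p} a prp 2∤p = subst (2 ∣_) (sym (ψ̄pp-odd a prp 2∤p))
  (∣n⇒∣m*n (p ^ a) (subst (2 ∣_) (+-comm 1 p) (odd⇒suc-even 2∤p)))

ψ̄-even : ∀ {n} → 0 < n → 2 < n → 2 ∣ ψ̄ n
ψ̄-even = prime-power-induction (λ n → 2 < n → 2 ∣ ψ̄ n) (λ { (s≤s ()) }) step
  where
  step : ∀ {p m} a → Prime p → p ∤ m → 0 < m → (2 < m → 2 ∣ ψ̄ m) →
    2 < p ^ suc a * m → 2 ∣ ψ̄ (p ^ suc a * m)
  step {p} {m} a prp p∤m m>0 ih n>2 =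
    subst (2 ∣_) (sym (ψ̄-prime-power-* a prp p∤m m>0)) (factors-even (prime⇒≡2⊎odd prp) a n>2)
    where
    factors-even : p ≡ 2 ⊎ 2 ∤ p → ∀ a → 2 < p ^ suc a * m → 2 ∣ ψ̄pp p (suc a) * ψ̄ m
    factors-even (inj₂ 2∤p) a _ = ∣m⇒∣m*n (ψ̄ m) (ψ̄pp-odd-even a prp 2∤p)
    factors-even (inj₁ refl) (suc a) _ = ∣m⇒∣m*n (ψ̄ m) (m∣m*n (2 ^ a))
    factors-even (inj₁ refl) zero 2<2m = ∣n⇒∣m*n 1 (ih (odd-cofactor>2 2<2m p∤m))

-- λ in terms of D

iter-suc : ∀ k (f : ℕ → ℕ) n → iter (suc k) f n ≡ iter k f (f n)
iter-suc zero f n = refl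
iter-suc (suc k) f n = cong f (iter-suc k f n)

iter-+ : ∀ j k (f : ℕ → ℕ) n → iter (j + k) f n ≡ iter j f (iter k f n)
iter-+ zero k f n = refl
iter-+ (suc j) k f n = cong f (iter-+ j k f n)

iter-ψ̄-2 : ∀ i → iter (suc i) ψ̄ 2 ≡ 1
iter-ψ̄-2 zero = refl
iter-ψ̄-2 (suc i) = cong ψ̄ (iter-ψ̄-2 i)

iter-ψ̄-never-returns-to-2 : ∀ {j k n} → iter j ψ̄ n ≡ 2 → j < k → iter k ψ̄ n ≢ 2
iter-ψ̄-never-returns-to-2 {j} {k} {n} ψ̄ʲn≡2 j<k ψ̄ᵏn≡2 with m≤n⇒∃[o]m+o≡n j<k
... | i , refl = 1≢2 (begin
  1                           ≡⟨ iter-ψ̄-2 i ⟨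
  iter (suc i) ψ̄ 2            ≡⟨ cong (iter (suc i) ψ̄) ψ̄ʲn≡2 ⟨
  iter (suc i) ψ̄ (iter j ψ̄ n) ≡⟨ iter-+ (suc i) j ψ̄ n ⟨
  iter (suc i + j) ψ̄ n        ≡⟨ cong (λ l → iter (suc l) ψ̄ n) (+-comm i j) ⟩
  iter (suc j + i) ψ̄ n        ≡⟨ ψ̄ᵏn≡2 ⟩
  2                           ∎)
  where
  open ≡-Reasoning
  1≢2 : 1 ≢ 2
  1≢2 ()

iter-ψ̄-≡2-unique : ∀ {j k n} → iter j ψ̄ n ≡ 2 → iter k ψ̄ n ≡ 2 → j ≡ k
iter-ψ̄-≡2-unique {j} {k} ψ̄ʲn≡2 ψ̄ᵏn≡2 with <-cmp j k
... | tri≈ _ j≡k _ = j≡k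
... | tri< j<k _ _ = ⊥-elim (iter-ψ̄-never-returns-to-2 ψ̄ʲn≡2 j<k ψ̄ᵏn≡2)
... | tri> _ _ k<j = ⊥-elim (iter-ψ̄-never-returns-to-2 ψ̄ᵏn≡2 k<j ψ̄ʲn≡2)

iter-ψ̄-even : ∀ k {n} → 0 < n → 2 ∣ n → D n ≡ suc k → iter k ψ̄ n ≡ 2
iter-ψ̄-even k {n} n>0 2∣n Dn≡1+k with n ≟ 2
iter-ψ̄-even zero _ _ _ | yes refl = refl
iter-ψ̄-even (suc k) _ _ D2≡2+k | yes refl with () ← trans (sym D-2) D2≡2+k
... | no n≢2 = stepped k Dψ̄n≡k
  where
  n>2 : 2 < n
  n>2 = ≤∧≢⇒< (even⇒>1 n>0 2∣n) (n≢2 ∘ sym)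
  ψ̄n>0 = ψ̄-positive n>0
  2∣ψ̄n = ψ̄-even n>0 n>2
  Dψ̄n≡k : D (ψ̄ n) ≡ k
  Dψ̄n≡k = suc-injective (trans (D-ψ̄-even n>0 2∣n) Dn≡1+k)
  stepped : ∀ k → D (ψ̄ n) ≡ k → iter k ψ̄ n ≡ 2
  stepped zero Dψ̄n≡0 = ⊥-elim (<⇒≢ (D-positive (even⇒>1 ψ̄n>0 2∣ψ̄n)) (sym Dψ̄n≡0))
  stepped (suc k) Dψ̄n≡1+k = trans (iter-suc k ψ̄ n) (iter-ψ̄-even k ψ̄n>0 2∣ψ̄n Dψ̄n≡1+k)

Lambda-odd : ∀ {n} → 1 < n → 2 ∤ n → Lambda n (D n)
Lambda-odd {n} n>1 2∤n = inj₂ (n>1 , subst (λ k → iter k ψ̄ n ≡ 2) (suc-pred (D n)) (begin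
  iter (suc (pred (D n))) ψ̄ n   ≡⟨ iter-suc (pred (D n)) ψ̄ n ⟩
  iter (pred (D n)) ψ̄ (ψ̄ n)     ≡⟨ iter-ψ̄-even (pred (D n)) (ψ̄-positive n>0) (ψ̄-even n>0 n>2) Dψ̄n≡ ⟩
  2                              ∎))
  where
  open ≡-Reasoning
  instance _ = >-nonZero (D-positive n>1)
  n>0 = <-trans z<s n>1
  Dψ̄n≡ : D (ψ̄ n) ≡ suc (pred (D n))
  Dψ̄n≡ = trans (D-ψ̄-odd n>0 2∤n) (sym (suc-pred (D n)))
  n>2 : 2 < n
  n>2 = ≤∧≢⇒< n>1 λ { refl → 2∤n ∣-refl }

Lambda-even : ∀ {n} → 0 < n → 2 ∣ n → Lambda n (pred (D n))
Lambda-even {n} n>0 2∣n = inj₂ (n>1 , iter-ψ̄-even (pred (D n)) n>0 2∣n (sym (suc-pred (D n))))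
  where
  n>1 = even⇒>1 n>0 2∣n
  instance _ = >-nonZero (D-positive n>1)

Lambda-unique : ∀ {n j k} → Lambda n j → Lambda n k → j ≡ k
Lambda-unique (inj₁ (_ , refl)) (inj₁ (_ , refl)) = refl
Lambda-unique (inj₁ (refl , _)) (inj₂ (1<1 , _)) = ⊥-elim (<-irrefl refl 1<1)
Lambda-unique (inj₂ (1<1 , _)) (inj₁ (refl , _)) = ⊥-elim (<-irrefl refl 1<1)
Lambda-unique (inj₂ (_ , ψ̄ʲn≡2)) (inj₂ (_ , ψ̄ᵏn≡2)) = iter-ψ̄-≡2-unique ψ̄ʲn≡2 ψ̄ᵏn≡2

Lambda-odd⇒D≡ : ∀ {n k} → 0 < n → 2 ∤ n → Lambda n k → D n ≡ k
Lambda-odd⇒D≡ {1} _ _ λ1≡k = trans D-1 (Lambda-unique (inj₁ (refl , refl)) λ1≡k)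
Lambda-odd⇒D≡ {suc (suc _)} _ 2∤n λn≡k = Lambda-unique (Lambda-odd (s≤s (s≤s z≤n)) 2∤n) λn≡k

Lambda-even⇒D≡ : ∀ {n k} → 0 < n → 2 ∣ n → Lambda n k → D n ≡ suc k
Lambda-even⇒D≡ {n} n>0 2∣n λn≡k = trans (sym (suc-pred (D n) {{>-nonZero (D-positive (even⇒>1 n>0 2∣n))}}))
                                         (cong suc (Lambda-unique (Lambda-even n>0 2∣n) λn≡k))

Lambda-even⇒D-half≡ : ∀ {n m k} → 0 < n → n ≡ 2 * m → Lambda n k → D m ≡ k
Lambda-even⇒D-half≡ {n} {m} {k} n>0 n≡2m λn≡k = suc-injective (begin
  suc (D m)     ≡⟨ cong (_+ D m) D-2 ⟨
  D 2 + D m     ≡⟨ D-* {2} {m} z<s (proj₁ (cofactor-bounds {2} {m = m} (s≤s (s≤s z≤n)) n>0 n≡2m)) ⟨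
  D (2 * m)     ≡⟨ cong D n≡2m ⟨
  D n           ≡⟨ Lambda-even⇒D≡ n>0 (subst (2 ∣_) (sym n≡2m) (m∣m*n m)) λn≡k ⟩
  suc k         ∎)
  where open ≡-Reasoning

-- The least number with a given value of D

ĝ : ℕ → ℕ
ĝ 0 = 1
ĝ 1 = 2
ĝ 2 = 3
ĝ 3 = 5
ĝ 4 = 9
ĝ (suc (suc (suc k@(suc (suc _))))) = 5 * ĝ k

ĝ-positive : ∀ k → 0 < ĝ k
ĝ-positive 0 = z<s
ĝ-positive 1 = z<s
ĝ-positive 2 = z<s
ĝ-positive 3 = z<s
ĝ-positive 4 = z<s
ĝ-positive (suc (suc (suc k@(suc (suc _))))) = *-positive {5} z<s (ĝ-positive k)

ĝ-odd : ∀ {k} → k ≢ 1 → 2 ∤ ĝ k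
ĝ-odd {0} _ = from-no (2 ∣? 1)
ĝ-odd {1} k≢1 = ⊥-elim (k≢1 refl)
ĝ-odd {2} _ = from-no (2 ∣? 3)
ĝ-odd {3} _ = from-no (2 ∣? 5)
ĝ-odd {4} _ = from-no (2 ∣? 9)
ĝ-odd {suc (suc (suc k@(suc (suc _))))} _ 2∣5ĝk =
  [ from-no (2 ∣? 5) , ĝ-odd {k} (λ ()) ]′ (euclidsLemma 5 (ĝ k) prime[2] 2∣5ĝk)

ĝ-submultiplicative : ∀ a b → ĝ (a + b) ≤ ĝ a * ĝ b
ĝ-submultiplicative 0 b = ≤-reflexive (sym (+-identityʳ (ĝ b)))
ĝ-submultiplicative a 0 = ≤-reflexive (trans (cong ĝ (+-identityʳ a)) (sym (*-identityʳ (ĝ a))))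
ĝ-submultiplicative (suc (suc (suc a@(suc (suc _))))) b = begin
  5 * ĝ (a + b)        ≤⟨ *-monoʳ-≤ 5 (ĝ-submultiplicative a b) ⟩
  5 * (ĝ a * ĝ b)      ≡⟨ *-assoc 5 (ĝ a) (ĝ b) ⟨
  5 * ĝ a * ĝ b        ∎
  where open ≤-Reasoning
ĝ-submultiplicative a (suc (suc (suc b@(suc (suc b₀))))) = begin
  ĝ (a + (3 + b))      ≡⟨ cong ĝ (+-Properties.x∙yz≈y∙xz a 3 b) ⟩
  ĝ (3 + (a + b))      ≡⟨ cong (ĝ ∘ (3 +_)) (+-Properties.x∙yz≈y∙xz a 2 b₀) ⟩
  5 * ĝ (2 + (a + b₀)) ≡⟨ cong (λ c → 5 * ĝ c) (+-Properties.x∙yz≈y∙xz a 2 b₀) ⟨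
  5 * ĝ (a + b)        ≤⟨ *-monoʳ-≤ 5 (ĝ-submultiplicative a b) ⟩
  5 * (ĝ a * ĝ b)      ≡⟨ x∙yz≈y∙xz 5 (ĝ a) (ĝ b) ⟩
  ĝ a * (5 * ĝ b)      ∎
  where open ≤-Reasoning
ĝ-submultiplicative 1 1 = ≤ᵇ⇒≤ _ _ _
ĝ-submultiplicative 1 2 = ≤ᵇ⇒≤ _ _ _
ĝ-submultiplicative 1 3 = ≤ᵇ⇒≤ _ _ _
ĝ-submultiplicative 1 4 = ≤ᵇ⇒≤ _ _ _
ĝ-submultiplicative 2 1 = ≤ᵇ⇒≤ _ _ _
ĝ-submultiplicative 2 2 = ≤ᵇ⇒≤ _ _ _
ĝ-submultiplicative 2 3 = ≤ᵇ⇒≤ _ _ _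
ĝ-submultiplicative 2 4 = ≤ᵇ⇒≤ _ _ _
ĝ-submultiplicative 3 1 = ≤ᵇ⇒≤ _ _ _
ĝ-submultiplicative 3 2 = ≤ᵇ⇒≤ _ _ _
ĝ-submultiplicative 3 3 = ≤ᵇ⇒≤ _ _ _
ĝ-submultiplicative 3 4 = ≤ᵇ⇒≤ _ _ _
ĝ-submultiplicative 4 1 = ≤ᵇ⇒≤ _ _ _
ĝ-submultiplicative 4 2 = ≤ᵇ⇒≤ _ _ _
ĝ-submultiplicative 4 3 = ≤ᵇ⇒≤ _ _ _
ĝ-submultiplicative 4 4 = ≤ᵇ⇒≤ _ _ _

D-ĝ : ∀ k → D (ĝ k) ≡ k
D-ĝ 0 = D-1
D-ĝ 1 = D-2
D-ĝ 2 = D-3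
D-ĝ 3 = D-5
D-ĝ 4 = trans (D-* {3} {3} z<s z<s) (cong₂ _+_ D-3 D-3)
D-ĝ (suc (suc (suc k@(suc (suc _))))) = trans (D-* {5} z<s (ĝ-positive k)) (cong₂ _+_ D-5 (D-ĝ k))

ĝ-D-prime≤ : ∀ {p} → Prime p → ĝ (D ⌈ p /2⌉) ≤ ⌈ p /2⌉ → ĝ (D p) ≤ p
ĝ-D-prime≤ {2} _ _ = ≤-reflexive (cong ĝ D-2)
ĝ-D-prime≤ {p@(suc (suc (suc _)))} prp ĝDx≤x = odd≤even⇒≤pred (begin
  ĝ (D p)               ≡⟨ cong ĝ (D-prime prp) ⟩
  ĝ (1 + D x)           ≤⟨ ĝ-submultiplicative 1 (D x) ⟩
  2 * ĝ (D x)           ≤⟨ *-monoʳ-≤ 2 ĝDx≤x ⟩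
  2 * x                 ≡⟨ odd⇒suc≡2*⌈/2⌉ 2∤p ⟨
  suc p                 ∎)
  (subst (2 ∤_) (cong ĝ (sym (D-prime prp))) (ĝ-odd 1+Dx≢1))
  (odd⇒suc-even 2∤p)
  where
  open ≤-Reasoning
  x = ⌈ p /2⌉
  2∤p : 2 ∤ p
  2∤p = [ (λ ()) , (λ 2∤p → 2∤p) ]′ (prime⇒≡2⊎odd prp)
  1+Dx≢1 : 1 + D x ≢ 1
  1+Dx≢1 1+Dx≡1 = <⇒≢ (D-positive {x} (s≤s (s≤s z≤n))) (sym (suc-injective 1+Dx≡1))

ĝ-D≤ : ∀ {n} → 0 < n → ĝ (D n) ≤ n
ĝ-D≤ {n} = <-rec (λ n → 0 < n → ĝ (D n) ≤ n) go n
  where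
  go : ∀ n → (∀ {m} → m < n → 0 < m → ĝ (D m) ≤ m) → 0 < n → ĝ (D n) ≤ n
  go 1 _ _ = ≤-reflexive (cong ĝ D-1)
  go n@(suc (suc _)) ih n>0 with prime-factor {n} (s≤s (s≤s z≤n))
  ... | p , m , prp , n≡pm = begin
    ĝ (D n)               ≡⟨ cong (ĝ ∘ D) n≡pm ⟩
    ĝ (D (p * m))         ≡⟨ cong ĝ (D-* (prime⇒>0 prp) m>0) ⟩
    ĝ (D p + D m)         ≤⟨ ĝ-submultiplicative (D p) (D m) ⟩
    ĝ (D p) * ĝ (D m)     ≤⟨ *-mono-≤ (ĝ-D-prime≤ prp (ih x<n x>0)) (ih m<n m>0) ⟩
    p * m                 ≡⟨ n≡pm ⟨
    n                     ∎
    where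
    open ≤-Reasoning
    m>0 = proj₁ (cofactor-bounds (prime⇒>1 prp) n>0 n≡pm)
    m<n = proj₂ (cofactor-bounds (prime⇒>1 prp) n>0 n≡pm)
    x<n : ⌈ p /2⌉ < n
    x<n = <-≤-trans (proj₂ (⌈n/2⌉-bounds (prime⇒>1 prp))) (∣⇒≤ (subst (p ∣_) (sym n≡pm) (m∣m*n m)))
    x>0 = proj₁ (⌈n/2⌉-bounds (prime⇒>1 prp))

residue-form : ∀ {k} → 1 < k → ∃[ i ] (k ≡ 2 + i * 3 ⊎ k ≡ 3 + i * 3 ⊎ k ≡ 4 + i * 3)
residue-form {1} (s≤s ())
residue-form {2} _ = 0 , inj₁ refl
residue-form {3} _ = 0 , inj₂ (inj₁ refl)
residue-form {4} _ = 0 , inj₂ (inj₂ refl)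
residue-form {suc (suc (suc k@(suc (suc _))))} _ with residue-form {k} (s≤s (s≤s z≤n))
... | i , inj₁ k≡ = suc i , inj₁ (cong (3 +_) k≡)
... | i , inj₂ (inj₁ k≡) = suc i , inj₂ (inj₁ (cong (3 +_) k≡))
... | i , inj₂ (inj₂ k≡) = suc i , inj₂ (inj₂ (cong (3 +_) k≡))

ĝ-2+3i : ∀ i → ĝ (2 + i * 3) ≡ 3 * 5 ^ i
ĝ-2+3i zero = refl
ĝ-2+3i (suc i) = trans (cong (5 *_) (ĝ-2+3i i)) (x∙yz≈y∙xz 5 3 (5 ^ i))

ĝ-3+3i : ∀ i → ĝ (3 + i * 3) ≡ 5 ^ suc i
ĝ-3+3i zero = refl
ĝ-3+3i (suc i) = cong (5 *_) (ĝ-3+3i i)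

ĝ-4+3i : ∀ i → ĝ (4 + i * 3) ≡ 9 * 5 ^ i
ĝ-4+3i zero = refl
ĝ-4+3i (suc i) = trans (cong (5 *_) (ĝ-4+3i i)) (x∙yz≈y∙xz 5 9 (5 ^ i))

g-2+3i : ∀ i → g (2 + i * 3) ≡ 3 * 5 ^ i
g-2+3i i with (2 + i * 3) % 3 | [m+kn]%n≡m%n 2 i 3
... | 2 | _ = cong (λ e → 3 * 5 ^ e) (m*n/n≡m i 3)

g-3+3i : ∀ i → g (3 + i * 3) ≡ 5 ^ suc i
g-3+3i i with (3 + i * 3) % 3 | m*n%n≡0 (suc i) 3
... | 0 | _ = cong (5 ^_) (m*n/n≡m (suc i) 3)

g-4+3i : ∀ i → g (4 + i * 3) ≡ 9 * 5 ^ i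
g-4+3i i with (4 + i * 3) % 3 | [m+kn]%n≡m%n 1 (suc i) 3
... | 1 | _ = cong (λ e → 9 * 5 ^ e) (m*n/n≡m i 3)

g≡ĝ : ∀ {k} → 1 < k → g k ≡ ĝ k
g≡ĝ k>1 with residue-form k>1
... | i , inj₁ refl = trans (g-2+3i i) (sym (ĝ-2+3i i))
... | i , inj₂ (inj₁ refl) = trans (g-3+3i i) (sym (ĝ-3+3i i))
... | i , inj₂ (inj₂ refl) = trans (g-4+3i i) (sym (ĝ-4+3i i))

g-solution : ∀ {k} → 1 < k → 1 < g k × 2 ∤ g k × D (g k) ≡ k
g-solution {k} k>1 = D>0⇒>1 gk>0 (subst (0 <_) (sym Dgk≡k) (<-trans z<s k>1)) ,
                     subst (2 ∤_) (sym gk≡ĝk) (ĝ-odd (>⇒≢ k>1)) , Dgk≡k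
  where
  gk≡ĝk = g≡ĝ k>1
  gk>0 = subst (0 <_) (sym gk≡ĝk) (ĝ-positive k)
  Dgk≡k : D (g k) ≡ k
  Dgk≡k = trans (cong D gk≡ĝk) (D-ĝ k)

g-least-odd : ∀ {k n} → 1 < k → 0 < n → 2 ∤ n → Lambda n k → g k ≤ n
g-least-odd {k} {n} k>1 n>0 2∤n λn≡k =
  subst (_≤ n) (trans (cong ĝ (Lambda-odd⇒D≡ n>0 2∤n λn≡k)) (sym (g≡ĝ k>1))) (ĝ-D≤ n>0)

g-least-even : ∀ {k n} → 1 < k → 0 < n → 2 ∣ n → Lambda n k → 2 * g k ≤ n
g-least-even {k} {n} k>1 n>0 2∣n λn≡k = begin
  2 * g k        ≡⟨ cong (2 *_) (trans (g≡ĝ k>1) (cong ĝ (sym (Lambda-even⇒D-half≡ {m = m} n>0 n≡2m λn≡k)))) ⟩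
  2 * ĝ (D m)    ≤⟨ *-monoʳ-≤ 2 (ĝ-D≤ (proj₁ (cofactor-bounds {2} {m = m} (s≤s (s≤s z≤n)) n>0 n≡2m))) ⟩
  2 * m          ≡⟨ n≡2m ⟨
  n              ∎
  where
  open ≤-Reasoning
  m = quotient 2∣n
  n≡2m = m∣n⇒n≡m*quotient 2∣n

theorem2p1 : (k : ℕ) → 1 < k →
    (Odd (g k) × Lambda (g k) k × ((n : ℕ) → 1 ≤ n → Odd n → Lambda n k → g k ≤ n))
    × (Even (2 * g k) × Lambda (2 * g k) k × ((n : ℕ) → 1 ≤ n → Even n → Lambda n k → 2 * g k ≤ n))
theorem2p1 k k>1 =
  ( 2∤⇒Odd 2∤gk
  , subst (Lambda (g k)) Dgk≡k (Lambda-odd gk>1 2∤gk)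
  , λ n n>0 odd → g-least-odd k>1 n>0 (Odd⇒2∤ odd) )
  , ( n∣m⇒m%n≡0 _ 2 2∣2gk
    , subst (Lambda (2 * g k)) (cong pred D2gk≡1+k) (Lambda-even (*-positive {2} z<s gk>0) 2∣2gk)
    , λ n n>0 even → g-least-even k>1 n>0 (m%n≡0⇒n∣m n 2 even) )
  where
  gk>1 = proj₁ (g-solution k>1)
  gk>0 = <-trans z<s gk>1
  2∤gk = proj₁ (proj₂ (g-solution k>1))
  Dgk≡k = proj₂ (proj₂ (g-solution k>1))
  2∣2gk = m∣m*n (g k)
  D2gk≡1+k : D (2 * g k) ≡ suc k
  D2gk≡1+k = trans (D-* {2} z<s gk>0) (cong₂ _+_ D-2 Dgk≡k)
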